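{- Let $n\ge 12$ be even and let $C=\{\mathbf{c}_1,\ldots,\mathbf{c}_6\}$ with $\mathbf{c}_1=\overline{0011}[n]$, $\mathbf{c}_2=101\cdot\overline{0}[n-3]$, $\mathbf{c}_3=\overline{0}[n-3]\cdot 100$, $\mathbf{c}_4=\overline{1100}[n]$, $\mathbf{c}_5=001\cdot\overline{0}[n-3]$, $\mathbf{c}_6=\overline{0}[n-3]\cdot 101$. If $\mathbf{x}\in\mathbb{F}_2^n\setminus(W_0\cup W_1\cup W_2\cup C)$, then $|T(\mathbf{x})|>2n-3$.
   Context: For $\mathbf{x}=(x_0,\ldots,x_{n-1})\in\mathbb{F}_2^n$, the derivative is $\partial\mathbf{x}=(x_0+x_1,\ldots,x_{n-2}+x_{n-1})\in\mathbb{F}_2^{n-1}$, with $\partial^0\mathbf{x}=\mathbf{x}$ and $\partial^i\mathbf{x}=\partial(\partial^{i-1}\mathbf{x})$. The Steinhaus triangle is $T(\mathbf{x})=(\mathbf{x},\partial\mathbf{x},\ldots,\partial^{n-1}\mathbf{x})$; $|\mathbf{y}|$ is the number of ones of a binary sequence and $|T(\mathbf{x})|=\sum_{i=0}^{n-1}|\partial^i\mathbf{x}|$. For fixed $n$, let $0=w_0<w_1<\cdots<w_m$ be the distinct values of $|T(\mathbf{x})|$ over $\mathbf{x}\in\mathbb{F}_2^n$, and $W_i=\{\mathbf{x}\in\mathbb{F}_2^n:|T(\mathbf{x})|=w_i\}$. Sequences are written as words; a dot denotes concatenation; $\overline{x_1\cdots x_p}[k]$ is the word of the first $k$ letters of the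 infinite periodic word $x_1\cdots x_px_1\cdots x_p\cdots$. -}

module Defs where

open import Data.Bool using (Bool; true; false; _xor_)
open import Data.Nat using (ℕ; zero; suc; _+_; _∸_; _<?_)
open import Data.Nat.Properties using (_≟_)
open import Data.List using (List; []; _∷_; _++_; map; filter; length; deduplicate; replicate; concatMap)
open import Data.Vec using (Vec; toList)
import Data.Vec as V
open import Relation.Binary.PropositionalEquality using (_≡_)

-- Binary words over F₂ = Bool (true = 1), written as lists.
Word : Set
Word = List Bool

ones : Word → ℕ
ones [] = 0
ones (true ∷ xs) = suc (ones xs)
ones (false ∷ xs) = ones xs

∂ : Word → Word
∂ [] = []
∂ (a ∷ []) = []
∂ (a ∷ b ∷ xs) = (a xor b) ∷ ∂ (b ∷ xs)

∂^ : ℕ → Word → Word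
∂^ zero x = x
∂^ (suc i) x = ∂^ i (∂ x)

triW : ℕ → Word → ℕ
triW zero x = 0
triW (suc k) x = ones x + triW k (∂ x)

-- |T(x)| for x ∈ F₂ⁿ : Σ_{i=0}^{n-1} |∂^i x|
weightT : ∀ {n} → Vec Bool n → ℕ
weightT {n} x = triW n (toList x)

allVecs : (n : ℕ) → List (Vec Bool n)
allVecs zero = V.[] ∷ []
allVecs (suc n) = concatMap (λ v → (false V.∷ v) ∷ (true V.∷ v) ∷ []) (allVecs n)

-- the distinct values w₀ < w₁ < … < w_m of |T(x)| (as an unordered duplicate-free list)
weightValues : (n : ℕ) → List ℕ
weightValues n = deduplicate _≟_ (map weightT (allVecs n))

-- index i such that |T(x)| = w_i : the number of distinct attained values below |T(x)|
weightRank : ∀ {n} → Vec Bool n → ℕ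
weightRank {n} x = length (filter (_<? weightT x) (weightValues n))

InW : ∀ {n} → ℕ → Vec Bool n → Set
InW i x = weightRank x ≡ i

-- first k letters of the infinite periodic word ppp…
periodic : Word → ℕ → Word
periodic [] k = []
periodic (a ∷ p) k = go k (a ∷ p)
  where
  go : ℕ → Word → Word
  go zero _ = []
  go (suc k) [] = go k (a ∷ p)
  go (suc k) (b ∷ []) = b ∷ go k (a ∷ p)
  go (suc k) (b ∷ c ∷ q) = b ∷ go k (c ∷ q)

O I : Bool
O = false
I = true

c₁ c₂ c₃ c₄ c₅ c₆ : ℕ → Word
c₁ n = periodic (O ∷ O ∷ I ∷ I ∷ []) n
c₂ n = (I ∷ O ∷ I ∷ []) ++ periodic (O ∷ []) (n ∸ 3)
c₃ n = periodic (O ∷ []) (n ∸ 3) ++ (I ∷ O ∷ O ∷ [])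
c₄ n = periodic (I ∷ I ∷ O ∷ O ∷ []) n
c₅ n = (O ∷ O ∷ I ∷ []) ++ periodic (O ∷ []) (n ∸ 3)
c₆ n = periodic (O ∷ []) (n ∸ 3) ++ (I ∷ O ∷ I ∷ [])

C : ℕ → List Word
C n = c₁ n ∷ c₂ n ∷ c₃ n ∷ c₄ n ∷ c₅ n ∷ c₆ n ∷ []

-- Call y light if |T(y)| ≤ 2|y| − 3. Since |T(y)| = |y| + |T(∂y)|, a light word of length
-- L + 1 is zero, has a single one, or is one of the two ∂-preimages of a light word of
-- length L; for L ≥ 16 a single one at distance at least 3 from both ends is too heavy, by
-- an overlap inequality for Steinhaus triangles. Starting from an exhaustive enumeration at
-- lengths 12, 14 and 16, this recursion shows that for every length L = 8 + r + 4q (q ≥ 1)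
-- the light words are instances αβ^qγ of one fixed finite list of patterns per residue r,
-- with a block β of length 4. The weight of each pattern is linear in q, which is certified
-- by following four derivatives, after which every block has vanished. For even n this
-- leaves only the weights 0, n and 3n/2 − 1 below 2n − 2, except on the exceptional set C;
-- so a word outside W₀ ∪ W₁ ∪ W₂ ∪ C is heavier than 2n − 3.
module Submission where

open import Defs
open import Data.Bool using (Bool; true; false; _xor_)
open import Data.Bool.Properties using (xor-assoc; xor-comm; xor-same) renaming (_≟_ to _≟𝔹_)
open import Data.Empty using (⊥; ⊥-elim)
open import Data.Nat using (ℕ; zero; suc; pred; _+_; _*_; _∸_; _≤_; _<_; z≤n; s≤s; _≤?_; _<?_)
open import Data.Nat.Properties
open import Algebra.Properties.CommutativeSemigroup +-commutativeSemigroup using (interchange)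
open import Data.Nat.DivMod using (_%_; _/_; m≡m%n+[m/n]*n; m%n<n)
open import Data.Nat.Divisibility using (_∣_; divides)
open import Data.Nat.Tactic.RingSolver using (solve-∀)
open import Data.List using (List; []; _∷_; _++_; [_]; length; replicate; map; filter; foldr; upTo)
open import Data.List.Properties using (length-++; length-replicate; ++-assoc; ++-identityʳ) renaming (≡-dec to ≡-dec-List)
open import Data.List.Membership.Propositional using (_∈_; find; lose)
open import Data.List.Membership.Propositional.Properties using (∈-map⁺; ∈-map⁻; ∈-++⁺ˡ; ∈-++⁺ʳ; ∈-upTo⁺; ∈-filter⁺; ∈-filter⁻)
open import Data.List.Relation.Unary.All using (All; []; _∷_; all?) renaming (lookup to lookupᴬ; tabulate to tabulateᴬ)
open import Data.List.Relation.Unary.AllPairs using ([]; _∷_)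
open import Data.List.Relation.Unary.Any using (Any; any?; here; there)
open import Data.List.Relation.Unary.Any.Properties using (deduplicate⁻)
open import Data.List.Relation.Unary.Unique.Propositional using (Unique)
open import Data.List.Relation.Unary.Unique.Propositional.Properties using () renaming (filter⁺ to unique-filter⁺)
open import Data.List.Relation.Unary.Unique.DecPropositional.Properties _≟_ using (deduplicate-!)
open import Data.Product using (_×_; _,_; ∃; ∃₂; proj₁; proj₂)
open import Data.Sum using (_⊎_; inj₁; inj₂; [_,_]′)
open import Data.Vec using (Vec; toList)
open import Data.Vec.Properties using (length-toList)
open import Relation.Binary using (DecidableEquality)
open import Relation.Binary.PropositionalEquality hiding ([_])
open import Relation.Nullary using (Dec; ¬_; yes; no)
open import Relation.Nullary.Decidable using (map′; _×-dec_; _⊎-dec_; from-yes)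

-- Weights of Steinhaus triangles

∣T∣ : Word → ℕ
∣T∣ w = triW (length w) w

∂-length : ∀ b w → length (∂ (b ∷ w)) ≡ length w
∂-length b [] = refl
∂-length b (c ∷ w) = cong suc (∂-length c w)

∣T∣-∂ : ∀ w → ∣T∣ w ≡ ones w + ∣T∣ (∂ w)
∣T∣-∂ [] = refl
∣T∣-∂ (b ∷ w) rewrite ∂-length b w = refl

ones-++ : ∀ u v → ones (u ++ v) ≡ ones u + ones v
ones-++ [] v = refl
ones-++ (true ∷ u) v = cong suc (ones-++ u v)
ones-++ (false ∷ u) v = ones-++ u v

∂-++-∷ : ∀ u b v → ∂ (u ++ b ∷ v) ≡ ∂ (u ++ [ b ]) ++ ∂ (b ∷ v)
∂-++-∷ [] b v = refl
∂-++-∷ (a ∷ []) b v = refl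
∂-++-∷ (a ∷ a′ ∷ u) b v = cong ((a xor a′) ∷_) (∂-++-∷ (a′ ∷ u) b v)

∂-++ : ∀ u v → ∃ λ J → ∂ (u ++ v) ≡ ∂ u ++ J ++ ∂ v
∂-++ [] v = [] , refl
∂-++ (a ∷ []) [] = [] , refl
∂-++ (a ∷ []) (b ∷ v) = [ a xor b ] , refl
∂-++ (a ∷ a′ ∷ u) v with ∂-++ (a′ ∷ u) v
... | J , eq = J , cong ((a xor a′) ∷_) eq

triW-[] : ∀ k → triW k [] ≡ 0
triW-[] zero = refl
triW-[] (suc k) = triW-[] k

triW-mono-∷ : ∀ k x s → triW k s ≤ triW k (x ∷ s)
triW-mono-∷ zero x s = z≤n
triW-mono-∷ (suc k) x [] = ≤-trans (≤-reflexive (triW-[] (suc k))) z≤n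
triW-mono-∷ (suc k) x (b ∷ s) =
  +-mono-≤ (ones-∷ x) (triW-mono-∷ k (x xor b) (∂ (b ∷ s)))
  where
  ones-∷ : ∀ x → ones (b ∷ s) ≤ ones (x ∷ b ∷ s)
  ones-∷ true = n≤1+n _
  ones-∷ false = ≤-refl

triW-mono-++ : ∀ k u s → triW k s ≤ triW k (u ++ s)
triW-mono-++ k [] s = ≤-refl
triW-mono-++ k (x ∷ u) s = ≤-trans (triW-mono-++ k u s) (triW-mono-∷ k x (u ++ s))

triW-superadditive : ∀ k u v → triW k u + triW k v ≤ triW k (u ++ v)
triW-superadditive zero u v = z≤n
triW-superadditive (suc k) u v with ∂-++ u v
... | J , eq = begin
  (ones u + triW k (∂ u)) + (ones v + triW k (∂ v))
    ≡⟨ interchange (ones u) (triW k (∂ u)) (ones v) (triW k (∂ v)) ⟩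
  (ones u + ones v) + (triW k (∂ u) + triW k (∂ v))
    ≤⟨ +-mono-≤ (≤-reflexive (sym (ones-++ u v)))
         (≤-trans (+-monoʳ-≤ (triW k (∂ u)) (triW-mono-++ k J (∂ v)))
                  (triW-superadditive k (∂ u) (J ++ ∂ v))) ⟩
  ones (u ++ v) + triW k (∂ u ++ J ++ ∂ v)
    ≡⟨ cong (λ w → ones (u ++ v) + triW k w) (sym eq) ⟩
  ones (u ++ v) + triW k (∂ (u ++ v)) ∎
  where open ≤-Reasoning

ones-overlap : ∀ u v w → ones (u ++ v) + ones (v ++ w) ≡ ones (u ++ v ++ w) + ones v
ones-overlap u v w rewrite ones-++ u v | ones-++ v w | ones-++ u (v ++ w) | ones-++ v w =
  arrange (ones u) (ones v) (ones w)
  where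
  arrange : ∀ a b c → (a + b) + (b + c) ≡ (a + (b + c)) + b
  arrange = solve-∀

triW-overlap : ∀ k u v w → triW k (u ++ v) + triW k (v ++ w) ≤ triW k (u ++ v ++ w) + triW k v
triW-overlap zero u v w = z≤n
triW-overlap (suc k) u [] w rewrite ++-identityʳ u = begin
  triW (suc k) u + triW (suc k) w ≤⟨ triW-superadditive (suc k) u w ⟩
  triW (suc k) (u ++ w)           ≡⟨ sym (+-identityʳ _) ⟩
  triW (suc k) (u ++ w) + 0       ≡⟨ cong (triW (suc k) (u ++ w) +_) (sym (triW-[] (suc k))) ⟩
  triW (suc k) (u ++ w) + triW (suc k) [] ∎
  where open ≤-Reasoning
triW-overlap (suc k) u (b ∷ v) w with ∂-++ (b ∷ v) w
... | J , eq = begin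
  (ones (u ++ b ∷ v) + triW k (∂ (u ++ b ∷ v))) + (ones (b ∷ v ++ w) + triW k (∂ (b ∷ v ++ w)))
    ≡⟨ cong₂ (λ x y → (ones (u ++ b ∷ v) + triW k x) + (ones (b ∷ v ++ w) + triW k y)) (∂-++-∷ u b v) eq ⟩
  (ones (u ++ b ∷ v) + triW k (U ++ V)) + (ones (b ∷ v ++ w) + triW k (V ++ W))
    ≡⟨ interchange (ones (u ++ b ∷ v)) (triW k (U ++ V)) (ones (b ∷ v ++ w)) (triW k (V ++ W)) ⟩
  (ones (u ++ b ∷ v) + ones (b ∷ v ++ w)) + (triW k (U ++ V) + triW k (V ++ W))
    ≤⟨ +-mono-≤ (≤-reflexive (ones-overlap u (b ∷ v) w)) (triW-overlap k U V W) ⟩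
  (ones (u ++ b ∷ v ++ w) + ones (b ∷ v)) + (triW k (U ++ V ++ W) + triW k V)
    ≡⟨ interchange (ones (u ++ b ∷ v ++ w)) (ones (b ∷ v)) (triW k (U ++ V ++ W)) (triW k V) ⟩
  (ones (u ++ b ∷ v ++ w) + triW k (U ++ V ++ W)) + (ones (b ∷ v) + triW k V)
    ≡⟨ cong (λ x → (ones (u ++ b ∷ v ++ w) + triW k x) + (ones (b ∷ v) + triW k V))
         (sym (trans (∂-++-∷ u b (v ++ w)) (cong (U ++_) eq))) ⟩
  (ones (u ++ b ∷ v ++ w) + triW k (∂ (u ++ b ∷ v ++ w))) + (ones (b ∷ v) + triW k V) ∎
  where
  open ≤-Reasoning
  U = ∂ (u ++ [ b ])
  V = ∂ (b ∷ v)
  W = J ++ ∂ w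

triW-length : ∀ k w → length w ≤ k → triW k w ≡ ∣T∣ w
triW-length k [] _ = triW-[] k
triW-length (suc k) (b ∷ w) (s≤s h) =
  cong (ones (b ∷ w) +_)
    (trans (triW-length k (∂ (b ∷ w)) (≤-trans (≤-reflexive (∂-length b w)) h))
           (cong (λ n → triW n (∂ (b ∷ w))) (∂-length b w)))

∣T∣-overlap : ∀ u v w → ∣T∣ (u ++ v) + ∣T∣ (v ++ w) ≤ ∣T∣ (u ++ v ++ w) + ∣T∣ v
∣T∣-overlap u v w = begin
  ∣T∣ (u ++ v) + ∣T∣ (v ++ w)
    ≡⟨ sym (cong₂ _+_ (triW-length K (u ++ v) left) (triW-length K (v ++ w) right)) ⟩
  triW K (u ++ v) + triW K (v ++ w)
    ≤⟨ triW-overlap K u v w ⟩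
  triW K (u ++ v ++ w) + triW K v
    ≡⟨ cong (∣T∣ (u ++ v ++ w) +_) (triW-length K v (≤-trans (prefix v w) right)) ⟩
  ∣T∣ (u ++ v ++ w) + ∣T∣ v ∎
  where
  open ≤-Reasoning
  K = length (u ++ v ++ w)
  prefix : ∀ u v → length u ≤ length (u ++ v)
  prefix u v = subst (length u ≤_) (sym (length-++ u)) (m≤m+n _ _)
  left : length (u ++ v) ≤ K
  left = subst (λ z → length (u ++ v) ≤ length z) (++-assoc u v w) (prefix (u ++ v) w)
  right : length (v ++ w) ≤ K
  right = subst (length (v ++ w) ≤_) (sym (length-++ u)) (m≤n+m _ _)

ones-replicate-false : ∀ n → ones (replicate n false) ≡ 0
ones-replicate-false zero = refl
ones-replicate-false (suc n) = ones-replicate-false n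

∂-replicate-false : ∀ n → ∂ (replicate n false) ≡ replicate (pred n) false
∂-replicate-false zero = refl
∂-replicate-false (suc zero) = refl
∂-replicate-false (suc (suc n)) = cong (false ∷_) (∂-replicate-false (suc n))

triW-replicate-false : ∀ k n → triW k (replicate n false) ≡ 0
triW-replicate-false zero n = refl
triW-replicate-false (suc k) n
  rewrite ones-replicate-false n | ∂-replicate-false n = triW-replicate-false k (pred n)

∣T∣-replicate-false : ∀ n → ∣T∣ (replicate n false) ≡ 0
∣T∣-replicate-false n = triW-replicate-false (length (replicate n false)) n

replicate-++ : ∀ m n (x : Bool) → replicate m x ++ replicate n x ≡ replicate (m + n) x
replicate-++ zero n x = refl
replicate-++ (suc m) n x = cong (x ∷_) (replicate-++ m n x)

-- Periodic patterns

data Block : Set where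
  block : Bool → Bool → Bool → Bool → Block

blockWord : Block → Word
blockWord (block a b c d) = a ∷ b ∷ c ∷ d ∷ []

𝟘 : Block
𝟘 = block false false false false

blocks : ℕ → Block → Word
blocks zero β = []
blocks (suc q) β = blockWord β ++ blocks q β

∂ᴮ : Block → Block
∂ᴮ (block a b c d) = block (a xor b) (b xor c) (c xor d) (d xor a)

record Pattern : Set where
  constructor pat
  field
    pre : Word
    blk : Block
    suf : Word

open Pattern

⟦_⟧ : Pattern → ℕ → Word
⟦ pat α β γ ⟧ q = α ++ blocks q β ++ γ

_≟ʷ_ : DecidableEquality Word
_≟ʷ_ = ≡-dec-List _≟𝔹_

blockWord-injective : ∀ {β β′} → blockWord β ≡ blockWord β′ → β ≡ β′
blockWord-injective {block _ _ _ _} {block _ _ _ _} refl = refl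

_≟ᴮ_ : DecidableEquality Block
β ≟ᴮ β′ = map′ blockWord-injective (cong blockWord) (blockWord β ≟ʷ blockWord β′)

_≟ᵖ_ : DecidableEquality Pattern
pat α β γ ≟ᵖ pat α′ β′ γ′ =
  map′ (λ { (refl , refl , refl) → refl }) (λ { refl → refl , refl , refl })
       (α ≟ʷ α′ ×-dec β ≟ᴮ β′ ×-dec γ ≟ʷ γ′)

_∈ᵖ?_ : ∀ p ps → Dec (p ∈ ps)
p ∈ᵖ? ps = any? (p ≟ᵖ_) ps

blocks-++ : ∀ m n β → blocks m β ++ blocks n β ≡ blocks (m + n) β
blocks-++ zero n β = refl
blocks-++ (suc m) n β = trans (++-assoc (blockWord β) (blocks m β) (blocks n β))
                              (cong (blockWord β ++_) (blocks-++ m n β))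

blocks-𝟘 : ∀ q → blocks q 𝟘 ≡ replicate (q * 4) false
blocks-𝟘 zero = refl
blocks-𝟘 (suc q) = cong (λ w → false ∷ false ∷ false ∷ false ∷ w) (blocks-𝟘 q)

⟦𝟘⟧ : ∀ α γ q → ⟦ pat α 𝟘 γ ⟧ q ≡ α ++ replicate (q * 4) false ++ γ
⟦𝟘⟧ α γ q = cong (λ w → α ++ w ++ γ) (blocks-𝟘 q)

∂-blocks : ∀ q β γ → ∂ (blocks (suc q) β ++ γ) ≡ blocks q (∂ᴮ β) ++ ∂ (blockWord β ++ γ)
∂-blocks zero (block a b c d) γ = refl
∂-blocks (suc q) (block a b c d) γ =
  cong (λ w → (a xor b) ∷ (b xor c) ∷ (c xor d) ∷ (d xor a) ∷ w) (∂-blocks q (block a b c d) γ)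

firstᴮ : Block → Bool
firstᴮ (block a _ _ _) = a

∂ᵖ : Pattern → Pattern
∂ᵖ (pat α β γ) = pat (∂ (α ++ [ firstᴮ β ])) (∂ᴮ β) (∂ (blockWord β ++ γ))

∂-⟦⟧ : ∀ p q → ∂ (⟦ p ⟧ (suc q)) ≡ ⟦ ∂ᵖ p ⟧ q
∂-⟦⟧ (pat α (block a b c d) γ) q =
  trans (∂-++-∷ α a (b ∷ c ∷ d ∷ blocks q (block a b c d) ++ γ))
        (cong (∂ (α ++ [ a ]) ++_) (∂-blocks q (block a b c d) γ))

fixedOnes blockOnes : Pattern → ℕ
fixedOnes p = ones (pre p) + ones (suf p)
blockOnes p = ones (blockWord (blk p))

ones-blocks : ∀ q β → ones (blocks q β) ≡ q * ones (blockWord β)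
ones-blocks zero β = refl
ones-blocks (suc q) β =
  trans (ones-++ (blockWord β) (blocks q β)) (cong (ones (blockWord β) +_) (ones-blocks q β))

ones-⟦⟧ : ∀ p q → ones (⟦ p ⟧ q) ≡ fixedOnes p + q * blockOnes p
ones-⟦⟧ (pat α β γ) q
  rewrite ones-++ α (blocks q β ++ γ) | ones-++ (blocks q β) γ | ones-blocks q β =
  arrange (ones α) (q * ones (blockWord β)) (ones γ)
  where
  arrange : ∀ a b c → a + (b + c) ≡ (a + c) + b
  arrange = solve-∀

length-blocks : ∀ q β → length (blocks q β) ≡ q * 4
length-blocks zero β = refl
length-blocks (suc q) (block a b c d) = cong (4 +_) (length-blocks q (block a b c d))

length-⟦⟧ : ∀ p q → length (⟦ p ⟧ q) ≡ length (pre p) + length (suf p) + q * 4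
length-⟦⟧ (pat α β γ) q
  rewrite length-++ α {blocks q β ++ γ} | length-++ (blocks q β) {γ} | length-blocks q β =
  arrange (length α) (q * 4) (length γ)
  where
  arrange : ∀ a b c → a + (b + c) ≡ (a + c) + b
  arrange = solve-∀

delay : ℕ → Pattern → Pattern
delay k (pat α β γ) = pat α β (blocks k β ++ γ)

⟦delay⟧ : ∀ k p q → ⟦ delay k p ⟧ q ≡ ⟦ p ⟧ (k + q)
⟦delay⟧ k (pat α β γ) q = cong (α ++_) (begin
  blocks q β ++ blocks k β ++ γ   ≡⟨ sym (++-assoc (blocks q β) (blocks k β) γ) ⟩
  (blocks q β ++ blocks k β) ++ γ ≡⟨ cong (_++ γ) (blocks-++ q k β) ⟩
  blocks (q + k) β ++ γ           ≡⟨ cong (λ n → blocks n β ++ γ) (+-comm q k) ⟩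
  blocks (k + q) β ++ γ           ∎)
  where open ≡-Reasoning

∂ᵖ^ : ℕ → Pattern → Pattern
∂ᵖ^ zero p = p
∂ᵖ^ (suc k) p = ∂ᵖ^ k (∂ᵖ p)

topOnes₀ topOnes₁ : ℕ → Pattern → ℕ
topOnes₀ zero p = 0
topOnes₀ (suc k) p = fixedOnes p + suc k * blockOnes p + topOnes₀ k (∂ᵖ p)
topOnes₁ zero p = 0
topOnes₁ (suc k) p = blockOnes p + topOnes₁ k (∂ᵖ p)

∣T∣-top-rows : ∀ k p q →
  ∣T∣ (⟦ p ⟧ (k + q)) ≡ topOnes₀ k p + topOnes₁ k p * q + ∣T∣ (⟦ ∂ᵖ^ k p ⟧ q)
∣T∣-top-rows zero p q = refl
∣T∣-top-rows (suc k) p q = begin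
  ∣T∣ (⟦ p ⟧ (suc k + q))
    ≡⟨ ∣T∣-∂ (⟦ p ⟧ (suc k + q)) ⟩
  ones (⟦ p ⟧ (suc k + q)) + ∣T∣ (∂ (⟦ p ⟧ (suc (k + q))))
    ≡⟨ cong₂ _+_ (ones-⟦⟧ p (suc k + q)) (cong ∣T∣ (∂-⟦⟧ p (k + q))) ⟩
  fixedOnes p + (suc k + q) * blockOnes p + ∣T∣ (⟦ ∂ᵖ p ⟧ (k + q))
    ≡⟨ cong (fixedOnes p + (suc k + q) * blockOnes p +_) (∣T∣-top-rows k (∂ᵖ p) q) ⟩
  fixedOnes p + (suc k + q) * blockOnes p + (topOnes₀ k (∂ᵖ p) + topOnes₁ k (∂ᵖ p) * q + R)
    ≡⟨ arrange (fixedOnes p) (blockOnes p) k q (topOnes₀ k (∂ᵖ p)) (topOnes₁ k (∂ᵖ p)) R ⟩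
  topOnes₀ (suc k) p + topOnes₁ (suc k) p * q + R ∎
  where
  open ≡-Reasoning
  R = ∣T∣ (⟦ ∂ᵖ^ k (∂ᵖ p) ⟧ q)
  arrange : ∀ f b k q t₀ t₁ r →
    f + (suc k + q) * b + (t₀ + t₁ * q + r) ≡ f + suc k * b + t₀ + (b + t₁) * q + r
  arrange = solve-∀

blank : Pattern → Pattern
blank p = pat (replicate (length (pre p)) false) 𝟘 (replicate (length (suf p)) false)

∣T∣-⟦blank⟧ : ∀ p q → ∣T∣ (⟦ blank p ⟧ q) ≡ 0
∣T∣-⟦blank⟧ p q = begin
  ∣T∣ (⟦ blank p ⟧ q)
    ≡⟨ cong ∣T∣ (⟦𝟘⟧ (replicate a false) (replicate c false) q) ⟩
  ∣T∣ (replicate a false ++ replicate (q * 4) false ++ replicate c false)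
    ≡⟨ cong (λ w → ∣T∣ (replicate a false ++ w)) (replicate-++ (q * 4) c false) ⟩
  ∣T∣ (replicate a false ++ replicate (q * 4 + c) false)
    ≡⟨ cong ∣T∣ (replicate-++ a (q * 4 + c) false) ⟩
  ∣T∣ (replicate (a + (q * 4 + c)) false)
    ≡⟨ ∣T∣-replicate-false (a + (q * 4 + c)) ⟩
  0 ∎
  where
  open ≡-Reasoning
  a = length (pre p)
  c = length (suf p)

-- Patterns of linear weight

intercept slope : Pattern → ℕ
intercept p = ∣T∣ (⟦ p ⟧ 0)
slope p = ∣T∣ (⟦ p ⟧ 1) ∸ intercept p

Fits : Pattern → ℕ → Set
Fits p q = ∣T∣ (⟦ p ⟧ q) ≡ intercept p + slope p * q

-- ∂ᴮ is 1 + S for the cyclic shift S of order 4, and (1 + S)⁴ = 1 + S⁴ = 0 over 𝔽₂, so four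
-- derivatives kill every block; the fourth derivative of the instance at 4 + q then either
-- vanishes or, for a zero block, is the instance at 3 + q.
Vanishing Recurring LinearCertificate : Pattern → Set
Vanishing p =
  ∂ᵖ^ 4 p ≡ blank (∂ᵖ^ 4 p) × topOnes₀ 4 p ≡ intercept p + slope p * 4 × topOnes₁ 4 p ≡ slope p
Recurring p = ∂ᵖ^ 4 p ≡ delay 3 p × topOnes₀ 4 p ≡ slope p × topOnes₁ 4 p ≡ 0
LinearCertificate p = Fits p 1 × Fits p 2 × Fits p 3 × (Vanishing p ⊎ Recurring p)

linearCertificate? : ∀ p → Dec (LinearCertificate p)
linearCertificate? p =
  fits? 1 ×-dec fits? 2 ×-dec fits? 3 ×-dec
  ((∂ᵖ^ 4 p ≟ᵖ blank (∂ᵖ^ 4 p) ×-dec topOnes₀ 4 p ≟ intercept p + slope p * 4 ×-dec topOnes₁ 4 p ≟ slope p)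
   ⊎-dec (∂ᵖ^ 4 p ≟ᵖ delay 3 p ×-dec topOnes₀ 4 p ≟ slope p ×-dec topOnes₁ 4 p ≟ 0))
  where
  fits? : ∀ q → Dec (Fits p q)
  fits? q = ∣T∣ (⟦ p ⟧ q) ≟ intercept p + slope p * q

fits-step : ∀ {p} → Vanishing p ⊎ Recurring p → ∀ q → Fits p (3 + q) → Fits p (4 + q)
fits-step {p} (inj₁ (vanish , t₀ , t₁)) q _ = begin
  ∣T∣ (⟦ p ⟧ (4 + q))
    ≡⟨ ∣T∣-top-rows 4 p q ⟩
  topOnes₀ 4 p + topOnes₁ 4 p * q + ∣T∣ (⟦ ∂ᵖ^ 4 p ⟧ q)
    ≡⟨ cong₂ (λ a b → a + b * q + ∣T∣ (⟦ ∂ᵖ^ 4 p ⟧ q)) t₀ t₁ ⟩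
  k₀ + k₁ * 4 + k₁ * q + ∣T∣ (⟦ ∂ᵖ^ 4 p ⟧ q)
    ≡⟨ cong (λ w → k₀ + k₁ * 4 + k₁ * q + ∣T∣ (⟦ w ⟧ q)) vanish ⟩
  k₀ + k₁ * 4 + k₁ * q + ∣T∣ (⟦ blank (∂ᵖ^ 4 p) ⟧ q)
    ≡⟨ cong (k₀ + k₁ * 4 + k₁ * q +_) (∣T∣-⟦blank⟧ (∂ᵖ^ 4 p) q) ⟩
  k₀ + k₁ * 4 + k₁ * q + 0
    ≡⟨ arrange k₀ k₁ q ⟩
  k₀ + k₁ * (4 + q) ∎
  where
  open ≡-Reasoning
  k₀ = intercept p
  k₁ = slope p
  arrange : ∀ a b q → a + b * 4 + b * q + 0 ≡ a + b * (4 + q)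
  arrange = solve-∀
fits-step {p} (inj₂ (recur , t₀ , t₁)) q fits₃₊q = begin
  ∣T∣ (⟦ p ⟧ (4 + q))
    ≡⟨ ∣T∣-top-rows 4 p q ⟩
  topOnes₀ 4 p + topOnes₁ 4 p * q + ∣T∣ (⟦ ∂ᵖ^ 4 p ⟧ q)
    ≡⟨ cong₂ (λ a b → a + b * q + ∣T∣ (⟦ ∂ᵖ^ 4 p ⟧ q)) t₀ t₁ ⟩
  k₁ + 0 * q + ∣T∣ (⟦ ∂ᵖ^ 4 p ⟧ q)
    ≡⟨ cong (λ w → k₁ + 0 * q + ∣T∣ (⟦ w ⟧ q)) recur ⟩
  k₁ + 0 * q + ∣T∣ (⟦ delay 3 p ⟧ q)
    ≡⟨ cong (λ w → k₁ + 0 * q + ∣T∣ w) (⟦delay⟧ 3 p q) ⟩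
  k₁ + 0 * q + ∣T∣ (⟦ p ⟧ (3 + q))
    ≡⟨ cong (k₁ + 0 * q +_) fits₃₊q ⟩
  k₁ + 0 * q + (k₀ + k₁ * (3 + q))
    ≡⟨ arrange k₀ k₁ q ⟩
  k₀ + k₁ * (4 + q) ∎
  where
  open ≡-Reasoning
  k₀ = intercept p
  k₁ = slope p
  arrange : ∀ a b q → b + 0 * q + (a + b * (3 + q)) ≡ a + b * (4 + q)
  arrange = solve-∀

certified-linear : ∀ {p} → LinearCertificate p → ∀ q → Fits p q
certified-linear {p} (f₁ , f₂ , f₃ , tail) = fits
  where
  k₀ = intercept p
  k₁ = slope p
  fits : ∀ q → Fits p q
  fits 0 = sym (trans (cong (k₀ +_) (*-zeroʳ k₁)) (+-identityʳ k₀))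
  fits 1 = f₁
  fits 2 = f₂
  fits 3 = f₃
  fits (suc (suc (suc (suc q)))) = fits-step tail q (fits (suc (suc (suc q))))

-- Preimages under ∂

∫ : Bool → Word → Word
∫ b [] = [ b ]
∫ b (c ∷ w) = b ∷ ∫ (b xor c) w

xor-falseʳ : ∀ b → b xor false ≡ b
xor-falseʳ b = xor-comm b false

xor-cancelˡ : ∀ b c → b xor (b xor c) ≡ c
xor-cancelˡ b c = trans (sym (xor-assoc b b c)) (cong (_xor c) (xor-same b))

∂-∫ : ∀ b w → ∂ (∫ b w) ≡ w
∂-∫ b [] = refl
∂-∫ b (c ∷ []) = cong [_] (xor-cancelˡ b c)
∂-∫ b (c ∷ d ∷ w) = cong₂ _∷_ (xor-cancelˡ b c) (∂-∫ (b xor c) (d ∷ w))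

∫-∂ : ∀ b w → ∫ b (∂ (b ∷ w)) ≡ b ∷ w
∫-∂ b [] = refl
∫-∂ b (c ∷ w) rewrite xor-cancelˡ b c = cong (b ∷_) (∫-∂ c w)

∫-init : Bool → Word → Word
∫-init b [] = []
∫-init b (c ∷ u) = b ∷ ∫-init (b xor c) u

∫-last : Bool → Word → Bool
∫-last b [] = b
∫-last b (c ∷ u) = ∫-last (b xor c) u

∫-++ : ∀ b u v → ∫ b (u ++ v) ≡ ∫-init b u ++ ∫ (∫-last b u) v
∫-++ b [] v = refl
∫-++ b (c ∷ u) v = cong (b ∷_) (∫-++ (b xor c) u v)

parity : Word → Bool
parity = foldr _xor_ false

∫-last-parity : ∀ b u → ∫-last b u ≡ b xor parity u
∫-last-parity b [] = sym (xor-falseʳ b)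
∫-last-parity b (c ∷ u) = trans (∫-last-parity (b xor c) u) (xor-assoc b c (parity u))

∫ᴮ : Bool → Block → Block
∫ᴮ b (block c₁ c₂ c₃ c₄) = block b (b xor c₁) ((b xor c₁) xor c₂) (((b xor c₁) xor c₂) xor c₃)

Integrable : Pattern → Set
Integrable p = parity (blockWord (blk p)) ≡ false

∫-blocks : ∀ b q β γ → parity (blockWord β) ≡ false →
  ∫ b (blocks q β ++ γ) ≡ blocks q (∫ᴮ b β) ++ ∫ b γ
∫-blocks b zero β γ _ = refl
∫-blocks b (suc q) (block c₁ c₂ c₃ c₄) γ even =
  trans (∫-++ b (blockWord β) (blocks q β ++ γ))
        (cong (blockWord (∫ᴮ b β) ++_)
              (trans (cong (λ c → ∫ c (blocks q β ++ γ)) returns) (∫-blocks b q β γ even)))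
  where
  β = block c₁ c₂ c₃ c₄
  returns : ∫-last b (blockWord β) ≡ b
  returns = trans (∫-last-parity b (blockWord β)) (trans (cong (b xor_) even) (xor-falseʳ b))

∫ᵖ : Bool → Pattern → Pattern
∫ᵖ b (pat α β γ) = pat (∫-init b α) (∫ᴮ (∫-last b α) β) (∫ (∫-last b α) γ)

∫-⟦⟧ : ∀ b p q → Integrable p → ∫ b (⟦ p ⟧ q) ≡ ⟦ ∫ᵖ b p ⟧ q
∫-⟦⟧ b (pat α β γ) q even =
  trans (∫-++ b α (blocks q β ++ γ)) (cong (∫-init b α ++_) (∫-blocks (∫-last b α) q β γ even))

-- Light words

Light : ℕ → Word → Set
Light L y = length y ≡ L × ∣T∣ y + 3 ≤ 2 * L

oneAt : ℕ → ℕ → Word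
oneAt j k = replicate j false ++ true ∷ replicate k false

length-oneAt : ∀ j k → length (oneAt j k) ≡ j + suc k
length-oneAt j k rewrite length-++ (replicate j false) {true ∷ replicate k false}
  | length-replicate j {false} | length-replicate k {false} = refl

ones-cases : ∀ y → y ≡ replicate (length y) false ⊎ (∃₂ λ j k → y ≡ oneAt j k) ⊎ 2 ≤ ones y
ones-cases [] = inj₁ refl
ones-cases (false ∷ y) with ones-cases y
... | inj₁ e = inj₁ (cong (false ∷_) e)
... | inj₂ (inj₁ (j , k , e)) = inj₂ (inj₁ (suc j , k , cong (false ∷_) e))
... | inj₂ (inj₂ two) = inj₂ (inj₂ two)
ones-cases (true ∷ y) with ones-cases y
... | inj₁ e = inj₂ (inj₁ (0 , length y , cong (true ∷_) e))
... | inj₂ (inj₁ (j , k , refl)) = inj₂ (inj₂ (s≤s (one≤ j)))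
  where
  one≤ : ∀ j → 1 ≤ ones (oneAt j k)
  one≤ zero = s≤s z≤n
  one≤ (suc j) = one≤ j
... | inj₂ (inj₂ two) = inj₂ (inj₂ (≤-trans two (n≤1+n _)))

data LightCase (L : ℕ) : Word → Set where
  zeros    : LightCase L (replicate (suc L) false)
  single   : ∀ j k → j + k ≡ L → LightCase L (oneAt j k)
  integral : ∀ b {y} → Light L y → LightCase L (∫ b y)

-- |T(y)| = |y| + |T(∂y)| and 2(L + 1) − 3 = (2L − 3) + 2, so a light word with at least
-- two ones has a light derivative.
light-cases : ∀ {L y} → Light (suc L) y → LightCase L y
light-cases {L} {y} (len , light) with ones-cases y
... | inj₁ e = subst (LightCase L) (sym (trans e (cong (λ n → replicate n false) len))) zeros
... | inj₂ (inj₁ (j , k , refl)) =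
  single j k (suc-injective (trans (sym (+-suc j k)) (trans (sym (length-oneAt j k)) len)))
light-cases {L} {b ∷ y} (len , light) | inj₂ (inj₂ two) =
  subst (LightCase L) (∫-∂ b y) (integral b (∂-len , ∂-light))
  where
  ∂-len : length (∂ (b ∷ y)) ≡ L
  ∂-len = trans (∂-length b y) (suc-injective len)
  ∂-light : ∣T∣ (∂ (b ∷ y)) + 3 ≤ 2 * L
  ∂-light = +-cancelˡ-≤ 2 _ _ (begin
    2 + (∣T∣ (∂ (b ∷ y)) + 3)          ≤⟨ +-monoˡ-≤ _ two ⟩
    ones (b ∷ y) + (∣T∣ (∂ (b ∷ y)) + 3) ≡⟨ sym (+-assoc (ones (b ∷ y)) _ 3) ⟩
    ones (b ∷ y) + ∣T∣ (∂ (b ∷ y)) + 3   ≡⟨ cong (_+ 3) (sym (∣T∣-∂ (b ∷ y))) ⟩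
    ∣T∣ (b ∷ y) + 3                      ≤⟨ light ⟩
    2 * suc L                            ≡⟨ *-suc 2 L ⟩
    2 + 2 * L                            ∎)
    where open ≤-Reasoning

integrals : List Word → List Word
integrals ws = map (∫ false) ws ++ map (∫ true) ws

∈-integrals : ∀ b {y ws} → y ∈ ws → ∫ b y ∈ integrals ws
∈-integrals false y∈ = ∈-++⁺ˡ (∈-map⁺ (∫ false) y∈)
∈-integrals true {ws = ws} y∈ = ∈-++⁺ʳ (map (∫ false) ws) (∈-map⁺ (∫ true) y∈)

oneAts : ℕ → List Word
oneAts L = map (λ j → oneAt j (L ∸ j)) (upTo (suc L))

lightWords : ℕ → List Word
lightWords zero = [ [] ]
lightWords (suc L) = filter (λ y → ∣T∣ y + 3 ≤? 2 * suc L)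
  (replicate (suc L) false ∷ oneAts L ++ integrals (lightWords L))

lightWords-complete : ∀ {L y} → Light L y → y ∈ lightWords L
lightWords-complete {zero} {[]} _ = here refl
lightWords-complete {suc L} h@(_ , light) =
  ∈-filter⁺ (λ y → ∣T∣ y + 3 ≤? 2 * suc L) (candidate (light-cases h)) light
  where
  candidate : ∀ {y} → LightCase L y →
    y ∈ replicate (suc L) false ∷ oneAts L ++ integrals (lightWords L)
  candidate zeros = here refl
  candidate (single j k e) =
    there (∈-++⁺ˡ (subst (λ k′ → oneAt j k′ ∈ oneAts L) k≡ (∈-map⁺ (λ i → oneAt i (L ∸ i)) (∈-upTo⁺ j<))))
    where
    k≡ : L ∸ j ≡ k
    k≡ = trans (cong (_∸ j) (sym e)) (m+n∸m≡n j k)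
    j< : j < suc L
    j< = s≤s (subst (j ≤_) e (m≤m+n j k))
  candidate (integral b h′) = there (∈-++⁺ʳ (oneAts L) (∈-integrals b (lightWords-complete h′)))

-- Words with a single one

spike : Word
spike = oneAt 3 3

ResidueBound : ℕ → Pattern → Set
ResidueBound s p = LinearCertificate p × 9 * s + 36 ≤ 4 * intercept p × 36 ≤ 4 * slope p

residueBound? : ∀ s p → Dec (ResidueBound s p)
residueBound? s p = linearCertificate? p ×-dec 9 * s + 36 ≤? 4 * intercept p ×-dec 36 ≤? 4 * slope p

residue-bound : (f : ℕ → Word) (fam : ℕ → Pattern) → (∀ s m → f (s + m * 4) ≡ ⟦ fam s ⟧ m) →
  All (λ s → ResidueBound s (fam s)) (upTo 4) → ∀ x → 9 * x + 36 ≤ 4 * ∣T∣ (f x)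
residue-bound f fam shape bounded x =
  subst (λ x → 9 * x + 36 ≤ 4 * ∣T∣ (f x)) (sym (m≡m%n+[m/n]*n x 4))
        (bound (x % 4) (x / 4) (lookupᴬ bounded (∈-upTo⁺ (m%n<n x 4))))
  where
  bound : ∀ s m → ResidueBound s (fam s) → 9 * (s + m * 4) + 36 ≤ 4 * ∣T∣ (f (s + m * 4))
  bound s m (cert , b₀ , b₁) = begin
    9 * (s + m * 4) + 36                          ≡⟨ arrange s m ⟩
    (9 * s + 36) + 36 * m                         ≤⟨ +-mono-≤ b₀ (*-monoˡ-≤ m b₁) ⟩
    4 * intercept (fam s) + 4 * slope (fam s) * m ≡⟨ factor (intercept (fam s)) (slope (fam s)) m ⟩
    4 * (intercept (fam s) + slope (fam s) * m)   ≡⟨ cong (4 *_) (sym (certified-linear cert m)) ⟩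
    4 * ∣T∣ (⟦ fam s ⟧ m)                         ≡⟨ cong (λ w → 4 * ∣T∣ w) (sym (shape s m)) ⟩
    4 * ∣T∣ (f (s + m * 4))                       ∎
    where
    open ≤-Reasoning
    arrange : ∀ s m → 9 * (s + m * 4) + 36 ≡ (9 * s + 36) + 36 * m
    arrange = solve-∀
    factor : ∀ a b m → 4 * a + 4 * b * m ≡ 4 * (a + b * m)
    factor = solve-∀

zeros-spike-bound : ∀ x → 9 * x + 36 ≤ 4 * ∣T∣ (replicate x false ++ spike)
zeros-spike-bound =
  residue-bound (λ x → replicate x false ++ spike) (λ s → pat (replicate s false) 𝟘 spike) shape
  (from-yes (all? (λ s → residueBound? s (pat (replicate s false) 𝟘 spike)) (upTo 4)))
  where
  shape : ∀ s m → replicate (s + m * 4) false ++ spike ≡ ⟦ pat (replicate s false) 𝟘 spike ⟧ m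
  shape s m = begin
    replicate (s + m * 4) false ++ spike
      ≡⟨ cong (_++ spike) (sym (replicate-++ s (m * 4) false)) ⟩
    (replicate s false ++ replicate (m * 4) false) ++ spike
      ≡⟨ ++-assoc (replicate s false) _ spike ⟩
    replicate s false ++ replicate (m * 4) false ++ spike
      ≡⟨ sym (⟦𝟘⟧ (replicate s false) spike m) ⟩
    ⟦ pat (replicate s false) 𝟘 spike ⟧ m ∎
    where open ≡-Reasoning

spike-zeros-bound : ∀ x → 9 * x + 36 ≤ 4 * ∣T∣ (spike ++ replicate x false)
spike-zeros-bound =
  residue-bound (λ x → spike ++ replicate x false) (λ s → pat spike 𝟘 (replicate s false)) shape
  (from-yes (all? (λ s → residueBound? s (pat spike 𝟘 (replicate s false))) (upTo 4)))
  where
  shape : ∀ s m → spike ++ replicate (s + m * 4) false ≡ ⟦ pat spike 𝟘 (replicate s false) ⟧ m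
  shape s m = begin
    spike ++ replicate (s + m * 4) false
      ≡⟨ cong (λ n → spike ++ replicate n false) (+-comm s (m * 4)) ⟩
    spike ++ replicate (m * 4 + s) false
      ≡⟨ cong (spike ++_) (sym (replicate-++ (m * 4) s false)) ⟩
    spike ++ replicate (m * 4) false ++ replicate s false
      ≡⟨ sym (⟦𝟘⟧ spike (replicate s false) m) ⟩
    ⟦ pat spike 𝟘 (replicate s false) ⟧ m ∎
    where open ≡-Reasoning

oneAt-around-spike : ∀ j k → oneAt (3 + j) (3 + k) ≡ replicate j false ++ spike ++ replicate k false
oneAt-around-spike j k = begin
  replicate (3 + j) false ++ true ∷ replicate (3 + k) false
    ≡⟨ cong (λ n → replicate n false ++ true ∷ replicate (3 + k) false) (+-comm 3 j) ⟩
  replicate (j + 3) false ++ true ∷ replicate (3 + k) false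
    ≡⟨ cong (_++ true ∷ replicate (3 + k) false) (sym (replicate-++ j 3 false)) ⟩
  (replicate j false ++ replicate 3 false) ++ true ∷ replicate (3 + k) false
    ≡⟨ ++-assoc (replicate j false) (replicate 3 false) _ ⟩
  replicate j false ++ spike ++ replicate k false ∎
  where open ≡-Reasoning

-- The overlap inequality around the spike 0001000, whose triangle has weight 9, gives
-- 4 (|T(y)| + 9) ≥ 9s + 72; and 9s + 36 > 4 (2s + 11) as soon as s ≥ 9.
oneAt-heavy : ∀ j k → 9 ≤ j + k → 12 + 2 * (j + k) ≤ ∣T∣ (oneAt (3 + j) (3 + k))
oneAt-heavy j k 9≤s = *-cancelˡ-< 4 (11 + 2 * s) (∣T∣ y) (begin-strict
  4 * (11 + 2 * s)  ≡⟨ expand s ⟩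
  8 * s + 44        <⟨ +-monoʳ-< (8 * s) (n<1+n 44) ⟩
  8 * s + (9 + 36)  ≤⟨ +-monoʳ-≤ (8 * s) (+-monoˡ-≤ 36 9≤s) ⟩
  8 * s + (s + 36)  ≡⟨ collect s ⟩
  9 * s + 36        ≤⟨ +-cancelʳ-≤ 36 _ _ four-bound ⟩
  4 * ∣T∣ y         ∎)
  where
  open ≤-Reasoning
  s = j + k
  y = oneAt (3 + j) (3 + k)
  u = replicate j false
  w = replicate k false
  expand : ∀ s → 4 * (11 + 2 * s) ≡ 8 * s + 44
  expand = solve-∀
  collect : ∀ s → 8 * s + (s + 36) ≡ 9 * s + 36
  collect = solve-∀
  split : ∀ j k → 9 * (j + k) + 36 + 36 ≡ (9 * j + 36) + (9 * k + 36)
  split = solve-∀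
  four-bound : 9 * s + 36 + 36 ≤ 4 * ∣T∣ y + 36
  four-bound = begin
    9 * s + 36 + 36                            ≡⟨ split j k ⟩
    (9 * j + 36) + (9 * k + 36)                ≤⟨ +-mono-≤ (zeros-spike-bound j) (spike-zeros-bound k) ⟩
    4 * ∣T∣ (u ++ spike) + 4 * ∣T∣ (spike ++ w) ≡⟨ sym (*-distribˡ-+ 4 (∣T∣ (u ++ spike)) _) ⟩
    4 * (∣T∣ (u ++ spike) + ∣T∣ (spike ++ w))   ≤⟨ *-monoʳ-≤ 4 (∣T∣-overlap u spike w) ⟩
    4 * (∣T∣ (u ++ spike ++ w) + 9)            ≡⟨ cong (λ z → 4 * (∣T∣ z + 9)) (sym (oneAt-around-spike j k)) ⟩
    4 * (∣T∣ y + 9)                            ≡⟨ *-distribˡ-+ 4 (∣T∣ y) 9 ⟩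
    4 * ∣T∣ y + 36                             ∎

-- Covering light words by patterns

len : ℕ → ℕ → ℕ
len r q = 8 + r + q * 4

len-≥16 : ∀ r q → 2 ≤ q → 16 ≤ len r q
len-≥16 r (suc (suc t)) (s≤s (s≤s _)) = ≤-trans (m≤m+n 16 (r + t * 4)) (≤-reflexive (arrange r t))
  where
  arrange : ∀ r t → 16 + (r + t * 4) ≡ 8 + r + (4 + (4 + t * 4))
  arrange = solve-∀

Covers : List Pattern → ℕ → ℕ → Set
Covers ps r q = ∀ y → Light (len r q) y → Any (λ p → y ≡ ⟦ p ⟧ q) ps

Enumerated : List Pattern → ℕ → ℕ → Set
Enumerated ps r q = All (λ y → Any (λ p → y ≡ ⟦ p ⟧ q) ps) (lightWords (len r q))

enumerated? : ∀ ps r q → Dec (Enumerated ps r q)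
enumerated? ps r q = all? (λ y → any? (λ p → y ≟ʷ ⟦ p ⟧ q) ps) (lightWords (len r q))

covers-by-enumeration : ∀ ps r q → Enumerated ps r q → Covers ps r q
covers-by-enumeration ps r q enumerated y light = lookupᴬ enumerated (lightWords-complete light)

zeroᵖ : ℕ → Pattern
zeroᵖ r = pat (replicate 4 false) 𝟘 (replicate (4 + r) false)

leftOneᵖ rightOneᵖ : ℕ → ℕ → Pattern
leftOneᵖ r j = pat (oneAt j (3 ∸ j)) 𝟘 (replicate (4 + r) false)
rightOneᵖ r k = pat (replicate 4 false) 𝟘 (oneAt (3 + r ∸ k) k)

trivialPatterns : ℕ → List Pattern
trivialPatterns r =
  zeroᵖ r ∷ leftOneᵖ r 0 ∷ leftOneᵖ r 1 ∷ leftOneᵖ r 2 ∷ rightOneᵖ r 0 ∷ rightOneᵖ r 1 ∷ rightOneᵖ r 2 ∷ []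

oneAt-++-zeros : ∀ j k m → oneAt j k ++ replicate m false ≡ oneAt j (k + m)
oneAt-++-zeros j k m = trans (++-assoc (replicate j false) (true ∷ replicate k false) _)
  (cong (λ w → replicate j false ++ true ∷ w) (replicate-++ k m false))

zeros-++-oneAt : ∀ m j k → replicate m false ++ oneAt j k ≡ oneAt (m + j) k
zeros-++-oneAt m j k = trans (sym (++-assoc (replicate m false) (replicate j false) _))
  (cong (_++ true ∷ replicate k false) (replicate-++ m j false))

zeroᵖ-instance : ∀ r q → replicate (len r q) false ≡ ⟦ zeroᵖ r ⟧ q
zeroᵖ-instance r q = sym (begin
  ⟦ zeroᵖ r ⟧ q
    ≡⟨ ⟦𝟘⟧ (replicate 4 false) (replicate (4 + r) false) q ⟩
  replicate 4 false ++ replicate (q * 4) false ++ replicate (4 + r) false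
    ≡⟨ cong (replicate 4 false ++_) (replicate-++ (q * 4) (4 + r) false) ⟩
  replicate (4 + (q * 4 + (4 + r))) false
    ≡⟨ cong (λ n → replicate n false) (arrange r q) ⟩
  replicate (len r q) false ∎)
  where
  open ≡-Reasoning
  arrange : ∀ r q → 4 + (q * 4 + (4 + r)) ≡ 8 + r + q * 4
  arrange = solve-∀

leftOneᵖ-instance : ∀ r q j k → j ≤ 3 → j + suc k ≡ len r q → oneAt j k ≡ ⟦ leftOneᵖ r j ⟧ q
leftOneᵖ-instance r q j k j≤3 e = sym (begin
  ⟦ leftOneᵖ r j ⟧ q
    ≡⟨ ⟦𝟘⟧ (oneAt j (3 ∸ j)) (replicate (4 + r) false) q ⟩
  oneAt j (3 ∸ j) ++ replicate (q * 4) false ++ replicate (4 + r) false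
    ≡⟨ cong (oneAt j (3 ∸ j) ++_) (replicate-++ (q * 4) (4 + r) false) ⟩
  oneAt j (3 ∸ j) ++ replicate (q * 4 + (4 + r)) false
    ≡⟨ oneAt-++-zeros j (3 ∸ j) (q * 4 + (4 + r)) ⟩
  oneAt j (3 ∸ j + (q * 4 + (4 + r)))
    ≡⟨ cong (oneAt j) (suc-injective (+-cancelˡ-≡ j _ _ (trans fill (sym e)))) ⟩
  oneAt j k ∎)
  where
  open ≡-Reasoning
  X = q * 4 + (4 + r)
  fill : j + suc (3 ∸ j + X) ≡ len r q
  fill = begin
    j + suc (3 ∸ j + X)   ≡⟨ regroup j (3 ∸ j) X ⟩
    j + (3 ∸ j) + suc X   ≡⟨ cong (_+ suc X) (m+[n∸m]≡n j≤3) ⟩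
    3 + suc X             ≡⟨ arrange r q ⟩
    len r q               ∎
    where
    regroup : ∀ a b x → a + suc (b + x) ≡ a + b + suc x
    regroup = solve-∀
    arrange : ∀ r q → 3 + suc (q * 4 + (4 + r)) ≡ 8 + r + q * 4
    arrange = solve-∀

rightOneᵖ-instance : ∀ r q j k → k ≤ 3 → j + suc k ≡ len r q → oneAt j k ≡ ⟦ rightOneᵖ r k ⟧ q
rightOneᵖ-instance r q j k k≤3 e = sym (begin
  ⟦ rightOneᵖ r k ⟧ q
    ≡⟨ ⟦𝟘⟧ (replicate 4 false) (oneAt (3 + r ∸ k) k) q ⟩
  replicate 4 false ++ replicate (q * 4) false ++ oneAt (3 + r ∸ k) k
    ≡⟨ cong (replicate 4 false ++_) (zeros-++-oneAt (q * 4) (3 + r ∸ k) k) ⟩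
  replicate 4 false ++ oneAt (q * 4 + (3 + r ∸ k)) k
    ≡⟨ zeros-++-oneAt 4 (q * 4 + (3 + r ∸ k)) k ⟩
  oneAt (4 + (q * 4 + (3 + r ∸ k))) k
    ≡⟨ cong (λ i → oneAt i k) (+-cancelʳ-≡ (suc k) (4 + (q * 4 + (3 + r ∸ k))) j (trans fill (sym e))) ⟩
  oneAt j k ∎)
  where
  open ≡-Reasoning
  fill : 4 + (q * 4 + (3 + r ∸ k)) + suc k ≡ len r q
  fill = begin
    4 + (q * 4 + (3 + r ∸ k)) + suc k ≡⟨ regroup (q * 4) (3 + r ∸ k) k ⟩
    5 + q * 4 + (3 + r ∸ k + k)       ≡⟨ cong (5 + q * 4 +_) (m∸n+n≡m (≤-trans k≤3 (m≤m+n 3 r))) ⟩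
    5 + q * 4 + (3 + r)               ≡⟨ arrange r q ⟩
    len r q                           ∎
    where
    regroup : ∀ a b k → 4 + (a + b) + suc k ≡ 5 + a + (b + k)
    regroup = solve-∀
    arrange : ∀ r q → 5 + q * 4 + (3 + r) ≡ 8 + r + q * 4
    arrange = solve-∀

far-one-not-light : ∀ j k → 16 ≤ 3 + j + (3 + k) → ¬ Light (suc (3 + j + (3 + k))) (oneAt (3 + j) (3 + k))
far-one-not-light j k 16≤ (_ , light) = 1+n≰n (+-cancelˡ-≤ (12 + 2 * (j + k)) 3 2 (begin
  12 + 2 * (j + k) + 3            ≤⟨ +-monoˡ-≤ 3 (oneAt-heavy j k 9≤) ⟩
  ∣T∣ (oneAt (3 + j) (3 + k)) + 3  ≤⟨ light ⟩
  2 * suc (3 + j + (3 + k))        ≡⟨ expand j k ⟩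
  12 + 2 * (j + k) + 2            ∎))
  where
  open ≤-Reasoning
  reorder : ∀ j k → 3 + j + (3 + k) ≡ 6 + (j + k)
  reorder = solve-∀
  expand : ∀ j k → 2 * suc (3 + j + (3 + k)) ≡ 12 + 2 * (j + k) + 2
  expand = solve-∀
  9≤ : 9 ≤ j + k
  9≤ = <⇒≤ (+-cancelˡ-≤ 6 10 (j + k) (subst (16 ≤_) (reorder j k) 16≤))

fixedLength : Pattern → ℕ
fixedLength p = length (pre p) + length (suf p)

liftedIntercept liftedSlope : Bool → Pattern → ℕ
liftedIntercept b p = fixedOnes (∫ᵖ b p) + intercept p
liftedSlope b p = blockOnes (∫ᵖ b p) + slope p

∣T∣-∫ᵖ : ∀ {p} b q → LinearCertificate p → Integrable p →
  ∣T∣ (⟦ ∫ᵖ b p ⟧ q) ≡ liftedIntercept b p + liftedSlope b p * q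
∣T∣-∫ᵖ {p} b q cert even = begin
  ∣T∣ (⟦ ∫ᵖ b p ⟧ q)
    ≡⟨ ∣T∣-∂ (⟦ ∫ᵖ b p ⟧ q) ⟩
  ones (⟦ ∫ᵖ b p ⟧ q) + ∣T∣ (∂ (⟦ ∫ᵖ b p ⟧ q))
    ≡⟨ cong₂ _+_ (ones-⟦⟧ (∫ᵖ b p) q) (cong ∣T∣ ∂-lifted) ⟩
  fixedOnes (∫ᵖ b p) + q * blockOnes (∫ᵖ b p) + ∣T∣ (⟦ p ⟧ q)
    ≡⟨ cong (fixedOnes (∫ᵖ b p) + q * blockOnes (∫ᵖ b p) +_) (certified-linear cert q) ⟩
  fixedOnes (∫ᵖ b p) + q * blockOnes (∫ᵖ b p) + (intercept p + slope p * q)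
    ≡⟨ arrange (fixedOnes (∫ᵖ b p)) (blockOnes (∫ᵖ b p)) (intercept p) (slope p) q ⟩
  liftedIntercept b p + liftedSlope b p * q ∎
  where
  open ≡-Reasoning
  ∂-lifted : ∂ (⟦ ∫ᵖ b p ⟧ q) ≡ ⟦ p ⟧ q
  ∂-lifted = trans (cong ∂ (sym (∫-⟦⟧ b p q even))) (∂-∫ b (⟦ p ⟧ q))
  arrange : ∀ f o a s q → f + q * o + (a + s * q) ≡ f + a + (o + s) * q
  arrange = solve-∀

Heavy : Bool → Pattern → Set
Heavy b p = 8 ≤ liftedSlope b p × 2 * fixedLength (∫ᵖ b p) + 14 ≤ liftedIntercept b p + 2 * liftedSlope b p

heavy? : ∀ b p → Dec (Heavy b p)
heavy? b p =
  8 ≤? liftedSlope b p ×-dec 2 * fixedLength (∫ᵖ b p) + 14 ≤? liftedIntercept b p + 2 * liftedSlope b p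

heavy-not-light : ∀ {p L} b q → LinearCertificate p → Integrable p → Heavy b p → 2 ≤ q →
  ¬ Light L (⟦ ∫ᵖ b p ⟧ q)
heavy-not-light {p} {L} b q@(suc (suc t)) cert even (steep , high) (s≤s (s≤s _)) (len , light) =
  <-irrefl refl (begin-strict
    ∣T∣ y + 3                             ≤⟨ light ⟩
    2 * L                                 ≡⟨ cong (2 *_) (sym len) ⟩
    2 * length y                          ≡⟨ cong (2 *_) (length-⟦⟧ (∫ᵖ b p) q) ⟩
    2 * (ℓ + q * 4)                       ≡⟨ split ℓ t ⟩
    (2 * ℓ + 14) + 8 * t + 2              <⟨ +-mono-≤-< (+-mono-≤ high (*-monoˡ-≤ t steep)) ≤-refl ⟩
    (k₀ + 2 * k₁) + k₁ * t + 3            ≡⟨ merge k₀ k₁ t ⟩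
    k₀ + k₁ * q + 3                       ≡⟨ cong (_+ 3) (sym (∣T∣-∫ᵖ b q cert even)) ⟩
    ∣T∣ y + 3                             ∎)
  where
  open ≤-Reasoning
  y = ⟦ ∫ᵖ b p ⟧ q
  ℓ = fixedLength (∫ᵖ b p)
  k₀ = liftedIntercept b p
  k₁ = liftedSlope b p
  split : ∀ ℓ t → 2 * (ℓ + suc (suc t) * 4) ≡ (2 * ℓ + 14) + 8 * t + 2
  split = solve-∀
  merge : ∀ a b t → (a + 2 * b) + b * t + 3 ≡ a + b * suc (suc t) + 3
  merge = solve-∀

Lifts : ℕ → List Pattern → Bool → Pattern → Set
Lifts δ ps b p = ∫ᵖ b p ∈ map (delay δ) ps ⊎ Heavy b p

Extends : ℕ → List Pattern → Pattern → Set
Extends δ ps p = Integrable p × Lifts δ ps false p × Lifts δ ps true p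

extends? : ∀ δ ps p → Dec (Extends δ ps p)
extends? δ ps p = parity (blockWord (blk p)) ≟𝔹 false ×-dec lifts? false ×-dec lifts? true
  where
  lifts? : ∀ b → Dec (Lifts δ ps b p)
  lifts? b = ∫ᵖ b p ∈ᵖ? map (delay δ) ps ⊎-dec heavy? b p

lifts : ∀ {δ ps p} → Extends δ ps p → ∀ b → Lifts δ ps b p
lifts (_ , l , _) false = l
lifts (_ , _ , l) true = l

single-cover : ∀ {ps} r q j k → All (_∈ ps) (trivialPatterns r) → 16 ≤ j + k → j + suc k ≡ len r q →
  Light (len r q) (oneAt j k) → Any (λ p → oneAt j k ≡ ⟦ p ⟧ q) ps
single-cover r q 0 k trivial _ e _ =
  lose (lookupᴬ trivial (there (here refl))) (leftOneᵖ-instance r q 0 k z≤n e)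
single-cover r q 1 k trivial _ e _ =
  lose (lookupᴬ trivial (there (there (here refl)))) (leftOneᵖ-instance r q 1 k (s≤s z≤n) e)
single-cover r q 2 k trivial _ e _ =
  lose (lookupᴬ trivial (there (there (there (here refl))))) (leftOneᵖ-instance r q 2 k (s≤s (s≤s z≤n)) e)
single-cover r q j@(suc (suc (suc _))) 0 trivial _ e _ =
  lose (lookupᴬ trivial (there (there (there (there (here refl)))))) (rightOneᵖ-instance r q j 0 z≤n e)
single-cover r q j@(suc (suc (suc _))) 1 trivial _ e _ =
  lose (lookupᴬ trivial (there (there (there (there (there (here refl)))))))
       (rightOneᵖ-instance r q j 1 (s≤s z≤n) e)
single-cover r q j@(suc (suc (suc _))) 2 trivial _ e _ =
  lose (lookupᴬ trivial (there (there (there (there (there (there (here refl))))))))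
       (rightOneᵖ-instance r q j 2 (s≤s (s≤s z≤n)) e)
single-cover r q (suc (suc (suc j))) (suc (suc (suc k))) _ 16≤ e light =
  ⊥-elim (far-one-not-light j k 16≤
    (subst (λ L → Light L (oneAt (3 + j) (3 + k))) (trans (sym e) (+-suc (3 + j) (3 + k))) light))

lift-cover : ∀ {ps′ ps L} δ q′ → 2 ≤ q′ → All LinearCertificate ps′ → All (Extends δ ps) ps′ →
  ∀ b {y} → Any (λ p → y ≡ ⟦ p ⟧ q′) ps′ → Light L (∫ b y) → Any (λ p → ∫ b y ≡ ⟦ p ⟧ (δ + q′)) ps
lift-cover {ps = ps} δ q′ 2≤q′ linear extends b y′∈ light with find y′∈
... | p , p∈ , refl with lookupᴬ extends p∈
... | ext@(even , _) with lifts {δ} {ps} {p} ext b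
... | inj₁ lifted with ∈-map⁻ (delay δ) lifted
...   | p″ , p″∈ , lifted≡ = lose p″∈ (begin
  ∫ b (⟦ p ⟧ q′)       ≡⟨ ∫-⟦⟧ b p q′ even ⟩
  ⟦ ∫ᵖ b p ⟧ q′        ≡⟨ cong (λ p → ⟦ p ⟧ q′) lifted≡ ⟩
  ⟦ delay δ p″ ⟧ q′    ≡⟨ ⟦delay⟧ δ p″ q′ ⟩
  ⟦ p″ ⟧ (δ + q′)      ∎)
  where open ≡-Reasoning
lift-cover δ q′ 2≤q′ linear _ b _ light | p , p∈ , refl | even , _ | inj₂ heavy =
  ⊥-elim (heavy-not-light b q′ (lookupᴬ linear p∈) even heavy 2≤q′
    (subst (Light _) (∫-⟦⟧ b p q′ even) light))

step : ∀ {ps′} ps r′ r q′ δ → len r (δ + q′) ≡ suc (len r′ q′) → 2 ≤ q′ →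
  All LinearCertificate ps′ → All (Extends δ ps) ps′ → All (_∈ ps) (trivialPatterns r) →
  Covers ps′ r′ q′ → Covers ps r (δ + q′)
step ps r′ r q′ δ grow 2≤q′ linear extends trivial covers′ y light =
  cover light (light-cases (subst (λ L → Light L y) grow light))
  where
  q = δ + q′
  cover : ∀ {y} → Light (len r q) y → LightCase (len r′ q′) y → Any (λ p → y ≡ ⟦ p ⟧ q) ps
  cover _ zeros =
    lose (lookupᴬ trivial (here refl)) (trans (cong (λ n → replicate n false) (sym grow)) (zeroᵖ-instance r q))
  cover light (single j k e) =
    single-cover r q j k trivial (subst (16 ≤_) (sym e) (len-≥16 r′ q′ 2≤q′))
      (trans (+-suc j k) (trans (cong suc e) (sym grow))) light
  cover light (integral b {y′} light′) = lift-cover δ q′ 2≤q′ linear extends b (covers′ y′ light′) light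

-- The light patterns for the lengths 8 + r + 4q, found by computer search; everything
-- used about them below is decided by evaluation.
light₀ : List Pattern
light₀ =
    pat (O ∷ O ∷ O ∷ O ∷ []) (block O O O O) (O ∷ O ∷ O ∷ O ∷ [])
  ∷ pat (O ∷ O ∷ O ∷ O ∷ []) (block O O O O) (O ∷ O ∷ O ∷ I ∷ [])
  ∷ pat (O ∷ O ∷ O ∷ O ∷ []) (block O O O O) (O ∷ O ∷ I ∷ O ∷ [])
  ∷ pat (O ∷ O ∷ O ∷ O ∷ []) (block O O O O) (O ∷ O ∷ I ∷ I ∷ [])
  ∷ pat (O ∷ O ∷ O ∷ O ∷ []) (block O O O O) (O ∷ I ∷ O ∷ O ∷ [])
  ∷ pat (O ∷ O ∷ O ∷ O ∷ []) (block O O O O) (O ∷ I ∷ O ∷ I ∷ [])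
  ∷ pat (O ∷ O ∷ I ∷ O ∷ []) (block O O O O) (O ∷ O ∷ O ∷ O ∷ [])
  ∷ pat (O ∷ O ∷ I ∷ I ∷ []) (block O O I I) (O ∷ O ∷ I ∷ I ∷ [])
  ∷ pat (O ∷ I ∷ O ∷ O ∷ []) (block O O O O) (O ∷ O ∷ O ∷ O ∷ [])
  ∷ pat (O ∷ I ∷ O ∷ I ∷ []) (block O I O I) (O ∷ I ∷ O ∷ I ∷ [])
  ∷ pat (I ∷ O ∷ O ∷ O ∷ []) (block O O O O) (O ∷ O ∷ O ∷ O ∷ [])
  ∷ pat (I ∷ O ∷ I ∷ O ∷ []) (block O O O O) (O ∷ O ∷ O ∷ O ∷ [])
  ∷ pat (I ∷ O ∷ I ∷ O ∷ []) (block I O I O) (I ∷ O ∷ I ∷ O ∷ [])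
  ∷ pat (I ∷ I ∷ O ∷ O ∷ []) (block O O O O) (O ∷ O ∷ O ∷ O ∷ [])
  ∷ pat (I ∷ I ∷ O ∷ O ∷ []) (block I I O O) (I ∷ I ∷ O ∷ O ∷ [])
  ∷ pat (I ∷ I ∷ I ∷ I ∷ []) (block I I I I) (I ∷ I ∷ I ∷ I ∷ [])
  ∷ []

light₁ : List Pattern
light₁ =
    pat (O ∷ O ∷ O ∷ O ∷ []) (block O O O O) (O ∷ O ∷ O ∷ O ∷ O ∷ [])
  ∷ pat (O ∷ O ∷ O ∷ O ∷ []) (block O O O O) (O ∷ O ∷ O ∷ O ∷ I ∷ [])
  ∷ pat (O ∷ O ∷ O ∷ O ∷ []) (block O O O O) (O ∷ O ∷ O ∷ I ∷ O ∷ [])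
  ∷ pat (O ∷ O ∷ O ∷ O ∷ []) (block O O O O) (O ∷ O ∷ O ∷ I ∷ I ∷ [])
  ∷ pat (O ∷ O ∷ O ∷ O ∷ []) (block O O O O) (O ∷ O ∷ I ∷ O ∷ O ∷ [])
  ∷ pat (O ∷ O ∷ O ∷ O ∷ []) (block O O O O) (O ∷ O ∷ I ∷ I ∷ O ∷ [])
  ∷ pat (O ∷ O ∷ I ∷ O ∷ []) (block O O O O) (O ∷ O ∷ O ∷ O ∷ O ∷ [])
  ∷ pat (O ∷ O ∷ I ∷ I ∷ []) (block O O I I) (O ∷ O ∷ I ∷ I ∷ O ∷ [])
  ∷ pat (O ∷ I ∷ O ∷ O ∷ []) (block O O O O) (O ∷ O ∷ O ∷ O ∷ O ∷ [])
  ∷ pat (O ∷ I ∷ O ∷ I ∷ []) (block O I O I) (O ∷ I ∷ O ∷ I ∷ O ∷ [])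
  ∷ pat (O ∷ I ∷ I ∷ O ∷ []) (block O O O O) (O ∷ O ∷ O ∷ O ∷ O ∷ [])
  ∷ pat (O ∷ I ∷ I ∷ O ∷ []) (block O I I O) (O ∷ I ∷ I ∷ O ∷ O ∷ [])
  ∷ pat (I ∷ O ∷ O ∷ O ∷ []) (block O O O O) (O ∷ O ∷ O ∷ O ∷ O ∷ [])
  ∷ pat (I ∷ O ∷ I ∷ O ∷ []) (block I O I O) (I ∷ O ∷ I ∷ O ∷ I ∷ [])
  ∷ pat (I ∷ I ∷ O ∷ O ∷ []) (block O O O O) (O ∷ O ∷ O ∷ O ∷ O ∷ [])
  ∷ pat (I ∷ I ∷ I ∷ I ∷ []) (block I I I I) (I ∷ I ∷ I ∷ I ∷ I ∷ [])
  ∷ []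

light₂ : List Pattern
light₂ =
    pat (O ∷ O ∷ O ∷ O ∷ []) (block O O O O) (O ∷ O ∷ O ∷ O ∷ O ∷ O ∷ [])
  ∷ pat (O ∷ O ∷ O ∷ O ∷ []) (block O O O O) (O ∷ O ∷ O ∷ O ∷ O ∷ I ∷ [])
  ∷ pat (O ∷ O ∷ O ∷ O ∷ []) (block O O O O) (O ∷ O ∷ O ∷ O ∷ I ∷ O ∷ [])
  ∷ pat (O ∷ O ∷ O ∷ O ∷ []) (block O O O O) (O ∷ O ∷ O ∷ O ∷ I ∷ I ∷ [])
  ∷ pat (O ∷ O ∷ O ∷ O ∷ []) (block O O O O) (O ∷ O ∷ O ∷ I ∷ O ∷ O ∷ [])
  ∷ pat (O ∷ O ∷ I ∷ O ∷ []) (block O O O O) (O ∷ O ∷ O ∷ O ∷ O ∷ O ∷ [])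
  ∷ pat (O ∷ O ∷ I ∷ I ∷ []) (block O O I I) (O ∷ O ∷ I ∷ I ∷ O ∷ O ∷ [])
  ∷ pat (O ∷ I ∷ O ∷ O ∷ []) (block O O O O) (O ∷ O ∷ O ∷ O ∷ O ∷ O ∷ [])
  ∷ pat (O ∷ I ∷ O ∷ I ∷ []) (block O I O I) (O ∷ I ∷ O ∷ I ∷ O ∷ I ∷ [])
  ∷ pat (I ∷ O ∷ O ∷ O ∷ []) (block O O O O) (O ∷ O ∷ O ∷ O ∷ O ∷ O ∷ [])
  ∷ pat (I ∷ O ∷ I ∷ O ∷ []) (block I O I O) (I ∷ O ∷ I ∷ O ∷ I ∷ O ∷ [])
  ∷ pat (I ∷ I ∷ O ∷ O ∷ []) (block O O O O) (O ∷ O ∷ O ∷ O ∷ O ∷ O ∷ [])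
  ∷ pat (I ∷ I ∷ I ∷ I ∷ []) (block I I I I) (I ∷ I ∷ I ∷ I ∷ I ∷ I ∷ [])
  ∷ []

light₃ : List Pattern
light₃ =
    pat (O ∷ O ∷ O ∷ O ∷ []) (block O O O O) (O ∷ O ∷ O ∷ O ∷ O ∷ O ∷ O ∷ [])
  ∷ pat (O ∷ O ∷ O ∷ O ∷ []) (block O O O O) (O ∷ O ∷ O ∷ O ∷ O ∷ O ∷ I ∷ [])
  ∷ pat (O ∷ O ∷ O ∷ O ∷ []) (block O O O O) (O ∷ O ∷ O ∷ O ∷ O ∷ I ∷ O ∷ [])
  ∷ pat (O ∷ O ∷ O ∷ O ∷ []) (block O O O O) (O ∷ O ∷ O ∷ O ∷ O ∷ I ∷ I ∷ [])
  ∷ pat (O ∷ O ∷ O ∷ O ∷ []) (block O O O O) (O ∷ O ∷ O ∷ O ∷ I ∷ O ∷ O ∷ [])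
  ∷ pat (O ∷ O ∷ O ∷ O ∷ []) (block O O O O) (O ∷ O ∷ O ∷ O ∷ I ∷ I ∷ I ∷ [])
  ∷ pat (O ∷ O ∷ I ∷ O ∷ []) (block O O O O) (O ∷ O ∷ O ∷ O ∷ O ∷ O ∷ O ∷ [])
  ∷ pat (O ∷ O ∷ I ∷ I ∷ []) (block O O I I) (O ∷ O ∷ I ∷ I ∷ O ∷ O ∷ I ∷ [])
  ∷ pat (O ∷ I ∷ O ∷ O ∷ []) (block O O O O) (O ∷ O ∷ O ∷ O ∷ O ∷ O ∷ O ∷ [])
  ∷ pat (O ∷ I ∷ O ∷ I ∷ []) (block O I O I) (O ∷ I ∷ O ∷ I ∷ O ∷ I ∷ O ∷ [])
  ∷ pat (I ∷ O ∷ O ∷ O ∷ []) (block O O O O) (O ∷ O ∷ O ∷ O ∷ O ∷ O ∷ O ∷ [])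
  ∷ pat (I ∷ O ∷ O ∷ I ∷ []) (block I O O I) (I ∷ O ∷ O ∷ I ∷ I ∷ O ∷ O ∷ [])
  ∷ pat (I ∷ O ∷ I ∷ O ∷ []) (block I O I O) (I ∷ O ∷ I ∷ O ∷ I ∷ O ∷ I ∷ [])
  ∷ pat (I ∷ I ∷ O ∷ O ∷ []) (block O O O O) (O ∷ O ∷ O ∷ O ∷ O ∷ O ∷ O ∷ [])
  ∷ pat (I ∷ I ∷ I ∷ O ∷ []) (block O O O O) (O ∷ O ∷ O ∷ O ∷ O ∷ O ∷ O ∷ [])
  ∷ pat (I ∷ I ∷ I ∷ I ∷ []) (block I I I I) (I ∷ I ∷ I ∷ I ∷ I ∷ I ∷ I ∷ [])
  ∷ []

light₀-linear : All LinearCertificate light₀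
light₀-linear = from-yes (all? linearCertificate? light₀)

light₁-linear : All LinearCertificate light₁
light₁-linear = from-yes (all? linearCertificate? light₁)

light₂-linear : All LinearCertificate light₂
light₂-linear = from-yes (all? linearCertificate? light₂)

light₃-linear : All LinearCertificate light₃
light₃-linear = from-yes (all? linearCertificate? light₃)

covers-12 : Covers light₀ 0 1
covers-12 = covers-by-enumeration light₀ 0 1 (from-yes (enumerated? light₀ 0 1))

covers-14 : Covers light₂ 2 1
covers-14 = covers-by-enumeration light₂ 2 1 (from-yes (enumerated? light₂ 2 1))

covers-16 : Covers light₀ 0 2
covers-16 = covers-by-enumeration light₀ 0 2 (from-yes (enumerated? light₀ 0 2))

covers-chain : ∀ t → Covers light₀ 0 (2 + t) →
  Covers light₁ 1 (2 + t) × Covers light₂ 2 (2 + t) × Covers light₃ 3 (2 + t)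
covers-chain t covers₀ = covers₁ , covers₂ , covers₃
  where
  2≤ : 2 ≤ 2 + t
  2≤ = s≤s (s≤s z≤n)
  covers₁ : Covers light₁ 1 (2 + t)
  covers₁ = step light₁ 0 1 (2 + t) 0 refl 2≤ light₀-linear (from-yes (all? (extends? 0 light₁) light₀))
              (from-yes (all? (_∈ᵖ? light₁) (trivialPatterns 1))) covers₀
  covers₂ : Covers light₂ 2 (2 + t)
  covers₂ = step light₂ 1 2 (2 + t) 0 refl 2≤ light₁-linear (from-yes (all? (extends? 0 light₂) light₁))
              (from-yes (all? (_∈ᵖ? light₂) (trivialPatterns 2))) covers₁
  covers₃ : Covers light₃ 3 (2 + t)
  covers₃ = step light₃ 2 3 (2 + t) 0 refl 2≤ light₂-linear (from-yes (all? (extends? 0 light₃) light₂))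
              (from-yes (all? (_∈ᵖ? light₃) (trivialPatterns 3))) covers₂

covers-from-16 : ∀ t → Covers light₀ 0 (2 + t)
covers-from-16 zero = covers-16
covers-from-16 (suc t) =
  step light₀ 3 0 (2 + t) 1 refl (s≤s (s≤s z≤n)) light₃-linear (from-yes (all? (extends? 1 light₀) light₃))
    (from-yes (all? (_∈ᵖ? light₀) (trivialPatterns 0)))
    (proj₂ (proj₂ (covers-chain t (covers-from-16 t))))

covers-even : ∀ t → Covers light₀ 0 (1 + t) × Covers light₂ 2 (1 + t)
covers-even zero = covers-12 , covers-14
covers-even (suc t) = covers-from-16 t , proj₁ (proj₂ (covers-chain t (covers-from-16 t)))

-- Weight classes and ranks

periodicᵖ : Block → ℕ → Pattern
periodicᵖ β r = pat (blockWord β) β (periodic (blockWord β) (4 + r))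

leadingᵖ trailingᵖ : Word → ℕ → Pattern
leadingᵖ u r = pat (u ++ [ false ]) 𝟘 (replicate (4 + r) false)
trailingᵖ u r = pat (replicate 4 false) 𝟘 (replicate (1 + r) false ++ u)

exceptional : ℕ → List Pattern
exceptional r =
  periodicᵖ (block O O I I) r ∷ leadingᵖ (I ∷ O ∷ I ∷ []) r ∷ trailingᵖ (I ∷ O ∷ O ∷ []) r ∷
  periodicᵖ (block I I O O) r ∷ leadingᵖ (O ∷ O ∷ I ∷ []) r ∷ trailingᵖ (I ∷ O ∷ I ∷ []) r ∷ []

periodic-blocks : ∀ β q m → periodic (blockWord β) (q * 4 + m) ≡ blocks q β ++ periodic (blockWord β) m
periodic-blocks β zero m = refl
periodic-blocks β@(block a b c d) (suc q) m = cong (λ w → a ∷ b ∷ c ∷ d ∷ w) (periodic-blocks β q m)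

blocks-swap : ∀ q β w → blocks q β ++ blockWord β ++ w ≡ blockWord β ++ blocks q β ++ w
blocks-swap zero (block a b c d) w = refl
blocks-swap (suc q) β@(block a b c d) w = cong (λ v → a ∷ b ∷ c ∷ d ∷ v) (blocks-swap q β w)

periodic-false : ∀ k → periodic [ false ] k ≡ replicate k false
periodic-false zero = refl
periodic-false (suc k) = cong (false ∷_) (periodic-false k)

periodicᵖ-instance : ∀ β r q → periodic (blockWord β) (len r q) ≡ ⟦ periodicᵖ β r ⟧ q
periodicᵖ-instance β@(block a b c d) r q = begin
  periodic (blockWord β) (len r q)
    ≡⟨ cong (periodic (blockWord β)) (arrange r q) ⟩
  periodic (blockWord β) (q * 4 + (4 + (4 + r)))
    ≡⟨ periodic-blocks β q (4 + (4 + r)) ⟩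
  blocks q β ++ blockWord β ++ periodic (blockWord β) (4 + r)
    ≡⟨ blocks-swap q β _ ⟩
  ⟦ periodicᵖ β r ⟧ q ∎
  where
  open ≡-Reasoning
  arrange : ∀ r q → 8 + r + q * 4 ≡ q * 4 + (4 + (4 + r))
  arrange = solve-∀

leadingᵖ-instance : ∀ u r q → u ++ periodic [ false ] (len r q ∸ 3) ≡ ⟦ leadingᵖ u r ⟧ q
leadingᵖ-instance u r q = sym (begin
  (u ++ [ false ]) ++ blocks q 𝟘 ++ replicate (4 + r) false
    ≡⟨ ++-assoc u [ false ] _ ⟩
  u ++ false ∷ blocks q 𝟘 ++ replicate (4 + r) false
    ≡⟨ cong (λ w → u ++ false ∷ w ++ replicate (4 + r) false) (blocks-𝟘 q) ⟩
  u ++ false ∷ replicate (q * 4) false ++ replicate (4 + r) false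
    ≡⟨ cong (λ w → u ++ false ∷ w) (replicate-++ (q * 4) (4 + r) false) ⟩
  u ++ replicate (suc (q * 4 + (4 + r))) false
    ≡⟨ cong (λ n → u ++ replicate n false) (arrange r q) ⟩
  u ++ replicate (len r q ∸ 3) false
    ≡⟨ cong (u ++_) (sym (periodic-false (len r q ∸ 3))) ⟩
  u ++ periodic [ false ] (len r q ∸ 3) ∎)
  where
  open ≡-Reasoning
  arrange : ∀ r q → suc (q * 4 + (4 + r)) ≡ 5 + r + q * 4
  arrange = solve-∀

trailingᵖ-instance : ∀ u r q → periodic [ false ] (len r q ∸ 3) ++ u ≡ ⟦ trailingᵖ u r ⟧ q
trailingᵖ-instance u r q = sym (begin
  replicate 4 false ++ blocks q 𝟘 ++ replicate (1 + r) false ++ u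
    ≡⟨ cong (λ w → replicate 4 false ++ w ++ replicate (1 + r) false ++ u) (blocks-𝟘 q) ⟩
  replicate 4 false ++ replicate (q * 4) false ++ replicate (1 + r) false ++ u
    ≡⟨ cong (replicate 4 false ++_) (sym (++-assoc (replicate (q * 4) false) _ u)) ⟩
  replicate 4 false ++ (replicate (q * 4) false ++ replicate (1 + r) false) ++ u
    ≡⟨ cong (λ w → replicate 4 false ++ w ++ u) (replicate-++ (q * 4) (1 + r) false) ⟩
  replicate (4 + (q * 4 + (1 + r))) false ++ u
    ≡⟨ cong (λ n → replicate n false ++ u) (arrange r q) ⟩
  replicate (len r q ∸ 3) false ++ u
    ≡⟨ cong (_++ u) (sym (periodic-false (len r q ∸ 3))) ⟩
  periodic [ false ] (len r q ∸ 3) ++ u ∎)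
  where
  open ≡-Reasoning
  arrange : ∀ r q → 4 + (q * 4 + (1 + r)) ≡ 5 + r + q * 4
  arrange = solve-∀

⟦exceptional⟧ : ∀ r q → map (λ p → ⟦ p ⟧ q) (exceptional r) ≡ C (len r q)
⟦exceptional⟧ r q = sym
  (cong₂ _∷_ (periodicᵖ-instance (block O O I I) r q)
  (cong₂ _∷_ (leadingᵖ-instance (I ∷ O ∷ I ∷ []) r q)
  (cong₂ _∷_ (trailingᵖ-instance (I ∷ O ∷ O ∷ []) r q)
  (cong₂ _∷_ (periodicᵖ-instance (block I I O O) r q)
  (cong₂ _∷_ (leadingᵖ-instance (O ∷ O ∷ I ∷ []) r q)
  (cong₂ _∷_ (trailingᵖ-instance (I ∷ O ∷ I ∷ []) r q) refl))))))

∈-exceptional : ∀ {p} r q → p ∈ exceptional r → ⟦ p ⟧ q ∈ C (len r q)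
∈-exceptional {p} r q p∈ = subst (⟦ p ⟧ q ∈_) (⟦exceptional⟧ r q) (∈-map⁺ (λ p → ⟦ p ⟧ q) p∈)

WeightClass : ℕ → ℕ → Word → Set
WeightClass n W y = ∣T∣ y ≡ 0 ⊎ ∣T∣ y ≡ n ⊎ ∣T∣ y ≡ W ⊎ (y ∈ C n × W < ∣T∣ y)

ClassCertificate : ℕ → ℕ → Pattern → Set
ClassCertificate r w p =
  (intercept p ≡ 0 × slope p ≡ 0) ⊎ (intercept p ≡ 8 + r × slope p ≡ 4) ⊎ (intercept p ≡ w × slope p ≡ 6) ⊎
  (p ∈ exceptional r × w < intercept p × 6 ≤ slope p)

classCertificate? : ∀ r w p → Dec (ClassCertificate r w p)
classCertificate? r w p =
  (intercept p ≟ 0 ×-dec slope p ≟ 0) ⊎-dec (intercept p ≟ 8 + r ×-dec slope p ≟ 4) ⊎-dec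
  (intercept p ≟ w ×-dec slope p ≟ 6) ⊎-dec (p ∈ᵖ? exceptional r ×-dec w <? intercept p ×-dec 6 ≤? slope p)

classified : ∀ {ps} r w q → Covers ps r q → All LinearCertificate ps → All (ClassCertificate r w) ps →
  ∀ y → Light (len r q) y → WeightClass (len r q) (w + 6 * q) y
classified r w q covers linear classes y light with find (covers y light)
... | p , p∈ , refl = classify (lookupᴬ classes p∈)
  where
  weight : ∣T∣ (⟦ p ⟧ q) ≡ intercept p + slope p * q
  weight = certified-linear (lookupᴬ linear p∈) q
  fixed : ∀ {a b} → intercept p ≡ a → slope p ≡ b → ∣T∣ (⟦ p ⟧ q) ≡ a + b * q
  fixed e₀ e₁ = trans weight (cong₂ (λ a b → a + b * q) e₀ e₁)
  classify : ClassCertificate r w p → WeightClass (len r q) (w + 6 * q) (⟦ p ⟧ q)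
  classify (inj₁ (e₀ , e₁)) = inj₁ (fixed e₀ e₁)
  classify (inj₂ (inj₁ (e₀ , e₁))) = inj₂ (inj₁ (trans (fixed e₀ e₁) (cong (8 + r +_) (*-comm 4 q))))
  classify (inj₂ (inj₂ (inj₁ (e₀ , e₁)))) = inj₂ (inj₂ (inj₁ (fixed e₀ e₁)))
  classify (inj₂ (inj₂ (inj₂ (p∈C , above , steep)))) = inj₂ (inj₂ (inj₂
    (∈-exceptional r q p∈C , subst (w + 6 * q <_) (sym weight) (+-mono-<-≤ above (*-monoˡ-≤ q steep)))))

pigeonhole : ∀ {a b x y z : ℕ} → x ≡ a ⊎ x ≡ b → y ≡ a ⊎ y ≡ b → z ≡ a ⊎ z ≡ b →
  x ≢ y → x ≢ z → y ≢ z → ⊥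
pigeonhole (inj₁ refl) (inj₁ refl) _ x≢y _ _ = x≢y refl
pigeonhole (inj₂ refl) (inj₂ refl) _ x≢y _ _ = x≢y refl
pigeonhole (inj₁ refl) (inj₂ refl) (inj₁ refl) _ x≢z _ = x≢z refl
pigeonhole (inj₁ refl) (inj₂ refl) (inj₂ refl) _ _ y≢z = y≢z refl
pigeonhole (inj₂ refl) (inj₁ refl) (inj₁ refl) _ _ y≢z = y≢z refl
pigeonhole (inj₂ refl) (inj₁ refl) (inj₂ refl) _ x≢z _ = x≢z refl

at-most-two : ∀ {a b : ℕ} {xs} → Unique xs → All (λ v → v ≡ a ⊎ v ≡ b) xs → length xs ≤ 2
at-most-two _ [] = z≤n
at-most-two _ (_ ∷ []) = s≤s z≤n
at-most-two _ (_ ∷ _ ∷ []) = s≤s (s≤s z≤n)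
at-most-two ((x≢y ∷ x≢z ∷ _) ∷ (y≢z ∷ _) ∷ _) (x∈ ∷ y∈ ∷ z∈ ∷ _) = ⊥-elim (pigeonhole x∈ y∈ z∈ x≢y x≢z y≢z)

weightT≡∣T∣ : ∀ {n} (x : Vec Bool n) → weightT x ≡ ∣T∣ (toList x)
weightT≡∣T∣ x = cong (λ m → triW m (toList x)) (sym (length-toList x))

light-toList : ∀ {n} (x : Vec Bool n) → 3 ≤ 2 * n → weightT x ≤ 2 * n ∸ 3 → Light n (toList x)
light-toList x 3≤ low =
  length-toList x , ≤-trans (+-monoˡ-≤ 3 (subst (_≤ _) (weightT≡∣T∣ x) low)) (≤-reflexive (m∸n+n≡m 3≤))

-- Every attained weight below |T(x)| ≤ 2n − 3 is the weight of a light word, hence 0 or n.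
rank≤2 : ∀ {n} W (x : Vec Bool n) → 3 ≤ 2 * n → n ≤ W → (∀ y → Light n y → WeightClass n W y) →
  ¬ (toList x ∈ C n) → weightT x ≤ 2 * n ∸ 3 → weightRank x ≤ 2
rank≤2 {n} W x 3≤ n≤W classes x∉C low =
  at-most-two (unique-filter⁺ (_<? weightT x) (deduplicate-! (map weightT (allVecs n)))) (tabulateᴬ below)
  where
  x≤W : weightT x ≤ W
  x≤W with classes (toList x) (light-toList x 3≤ low)
  ... | inj₁ e = subst (_≤ W) (sym (trans (weightT≡∣T∣ x) e)) z≤n
  ... | inj₂ (inj₁ e) = subst (_≤ W) (sym (trans (weightT≡∣T∣ x) e)) n≤W
  ... | inj₂ (inj₂ (inj₁ e)) = ≤-reflexive (trans (weightT≡∣T∣ x) e)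
  ... | inj₂ (inj₂ (inj₂ (x∈C , _))) = ⊥-elim (x∉C x∈C)
  below : ∀ {v} → v ∈ filter (_<? weightT x) (weightValues n) → v ≡ 0 ⊎ v ≡ n
  below {v} v∈ with ∈-filter⁻ (_<? weightT x) {v} {weightValues n} v∈
  ... | v∈values , v<x with ∈-map⁻ weightT (deduplicate⁻ _≟_ v∈values)
  ... | y , _ , refl with classes (toList y) (light-toList y 3≤ (≤-trans (<⇒≤ v<x) low))
  ...   | inj₁ e = inj₁ (trans (weightT≡∣T∣ y) e)
  ...   | inj₂ (inj₁ e) = inj₂ (trans (weightT≡∣T∣ y) e)
  ...   | inj₂ (inj₂ (inj₁ e)) = ⊥-elim (<⇒≱ v<x (subst (weightT x ≤_) (sym (trans (weightT≡∣T∣ y) e)) x≤W))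
  ...   | inj₂ (inj₂ (inj₂ (_ , W<y))) =
    ⊥-elim (<⇒≱ (<-trans (subst (W <_) (sym (weightT≡∣T∣ y)) W<y) v<x) x≤W)

even-length : ∀ n → 12 ≤ n → 2 ∣ n → ∃ λ t → n ≡ len 0 (1 + t) ⊎ n ≡ len 2 (1 + t)
even-length n 12≤n (divides k refl) =
  subst (λ k → ∃ λ t → k * 2 ≡ len 0 (1 + t) ⊎ k * 2 ≡ len 2 (1 + t))
        (m+[n∸m]≡n (*-cancelʳ-≤ 6 k 2 12≤n)) (shape (k ∸ 6))
  where
  grow : ∀ m → (6 + suc (suc m)) * 2 ≡ 4 + (6 + m) * 2
  grow = solve-∀
  len-suc : ∀ r t → 4 + (8 + r + (1 + t) * 4) ≡ 8 + r + (2 + t) * 4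
  len-suc = solve-∀
  shape : ∀ m → ∃ λ t → (6 + m) * 2 ≡ len 0 (1 + t) ⊎ (6 + m) * 2 ≡ len 2 (1 + t)
  shape 0 = 0 , inj₁ refl
  shape 1 = 0 , inj₂ refl
  shape (suc (suc m)) with shape m
  ... | t , inj₁ e = suc t , inj₁ (trans (grow m) (trans (cong (4 +_) e) (len-suc 0 t)))
  ... | t , inj₂ e = suc t , inj₂ (trans (grow m) (trans (cong (4 +_) e) (len-suc 2 t)))

len≤ : ∀ r w q → 8 + r ≤ w → len r q ≤ w + 6 * q
len≤ r w q h = +-mono-≤ h (≤-trans (*-monoʳ-≤ q (from-yes (4 ≤? 6))) (≤-reflexive (*-comm q 6)))

-- The third weight is W = 3n/2 − 1, i.e. 11 + 6q for n = 8 + 4q and 14 + 6q for n = 10 + 4q.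
light-classes : ∀ n → 12 ≤ n → 2 ∣ n → ∃ λ W → n ≤ W × (∀ y → Light n y → WeightClass n W y)
light-classes n 12≤n 2∣n with even-length n 12≤n 2∣n
... | t , inj₁ refl =
  11 + 6 * (1 + t) , len≤ 0 11 (1 + t) (from-yes (8 ≤? 11)) ,
  classified 0 11 (1 + t) (proj₁ (covers-even t)) light₀-linear
    (from-yes (all? (classCertificate? 0 11) light₀))
... | t , inj₂ refl =
  14 + 6 * (1 + t) , len≤ 2 14 (1 + t) (from-yes (10 ≤? 14)) ,
  classified 2 14 (1 + t) (proj₂ (covers-even t)) light₂-linear
    (from-yes (all? (classCertificate? 2 14) light₂))

≤2-cases : ∀ {m} → m ≤ 2 → m ≡ 0 ⊎ m ≡ 1 ⊎ m ≡ 2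
≤2-cases z≤n = inj₁ refl
≤2-cases (s≤s z≤n) = inj₂ (inj₁ refl)
≤2-cases (s≤s (s≤s z≤n)) = inj₂ (inj₂ refl)

proposition6p8 : (n : ℕ) → 12 ≤ n → 2 ∣ n → (x : Vec Bool n) →
    ¬ InW 0 x → ¬ InW 1 x → ¬ InW 2 x → ¬ (toList x ∈ C n) →
    2 * n ∸ 3 < weightT x
proposition6p8 n 12≤n 2∣n x ¬W₀ ¬W₁ ¬W₂ x∉C with 2 * n ∸ 3 <? weightT x | light-classes n 12≤n 2∣n
... | yes heavy | _ = heavy
... | no ¬heavy | W , n≤W , classes =
  ⊥-elim ([ ¬W₀ , [ ¬W₁ , ¬W₂ ]′ ]′ (≤2-cases (rank≤2 W x 3≤2n n≤W classes x∉C (≮⇒≥ ¬heavy))))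
  where
  3≤2n : 3 ≤ 2 * n
  3≤2n = ≤-trans (s≤s (s≤s (s≤s z≤n))) (≤-trans 12≤n (m≤m+n n _))
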